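{- Let $t$ be an $\mathrm{SL}_2$-tiling with $t_{jp}=1$. (i) If $t_{xy}=1$ for some $(x,y)$ with $x<j$ and $y>p$, then exactly one of the following holds: $t_{xp}=1$ for some $x<j$; or $t_{jy}=1$ for some $y>p$. (ii) If $t_{xy}=1$ for some $(x,y)$ with $x>j$ and $y<p$, then exactly one of the following holds: $t_{xp}=1$ for some $x>j$; or $t_{jy}=1$ for some $y<p$.
   Context: An $\mathrm{SL}_2$-tiling is a map $t:\mathbb{Z}\times\mathbb{Z}\to\{1,2,3,\dots\}$, $(i,j)\mapsto t_{ij}$, with $t_{ij}t_{i+1,j+1}-t_{i,j+1}t_{i+1,j}=1$ for all $i,j$. -}

module Defs where

open import Data.Nat using (ℕ; _≥_)
open import Data.Integer using (ℤ; _+_; +_)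
open import Data.Product using (_×_)
open import Data.Sum using (_⊎_)
open import Relation.Nullary using (¬_)
open import Relation.Binary.PropositionalEquality using (_≡_)

-- An SL₂-tiling: t : ℤ × ℤ → positive integers with
-- t i j * t (i+1) (j+1) - t i (j+1) * t (i+1) j = 1.
-- Values are taken in ℕ with positivity imposed; the diamond rule is
-- written additively (no subtraction) in ℕ.
record SL2Tiling : Set where
  field
    t        : ℤ → ℤ → ℕ
    positive : ∀ i j → t i j ≥ 1
    diamond  : ∀ i j → t i j Data.Nat.* t (i + + 1) (j + + 1)
                       ≡ 1 Data.Nat.+ t i (j + + 1) Data.Nat.* t (i + + 1) j

ExactlyOne : Set → Set → Set
ExactlyOne A B = (A ⊎ B) × ¬ (A × B)

module Submission where

-- Read from the corner (j , p), each of the two quadrants in question is an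
-- array u d e (d , e ∈ ℕ) of positive integers with u 0 0 = 1 satisfying
-- the unimodular rule  u (d+1) e · u d (e+1) = 1 + u (d+1) (e+1) · u d e.
-- Such an array factorises through its axes:
--   u d e + α d · β e = u d 0 · u 0 e,
-- where α d = u d 0 · u 0 1 - u d 1 and β is the same minor of the
-- transposed array.  The right-hand side minus α·β is again unimodular
-- (a 2×2 Cauchy–Binet computation), and a unimodular array with positive
-- entries is determined by its first row and column, which gives the
-- factorisation.  Along each axis (u · 0 , α) is a unimodular pair of
-- sequences; for such pairs α is positive and a descent argument turns
-- u (d+1) 0 ≤ α (d+1) into a 1 on the axis.  A 1 in the interior forces
-- one of these inequalities, and 1s on both axes would make the interior
-- entries too small.  Both parts of the proposition are then instances of
-- this quadrant theorem, for the quadrants north-east and south-west of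
-- (j , p).

open import Defs
open import Data.Integer using (ℤ; _<_; _>_)
open import Data.Product using (_×_; ∃-syntax)
open import Relation.Binary.PropositionalEquality using (_≡_)

open import Algebra.Bundles using (AbelianGroup)
open import Data.Nat as ℕ using (ℕ; zero; suc)
open import Data.Integer
  using (+_; 0ℤ; _+_; _-_; _*_; -_; ∣_∣; _≤_; +≤+; +<+; positive; nonNegative; >-nonZero)
open import Data.Integer.Properties
open import Data.Integer.Tactic.RingSolver using (solve-∀)
open import Algebra.Properties.Group (AbelianGroup.group +-0-abelianGroup)
  using (∙-cancelˡ)
open import Data.Product using (_,_)
open import Data.Sum using (_⊎_; inj₁; inj₂) renaming (map to ⊎-map)
open import Data.Empty using (⊥-elim)
open import Function.Bundles using (_⇔_; mk⇔; Equivalence)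
open import Relation.Nullary using (¬_; yes; no)
open import Relation.Binary.PropositionalEquality
  using (refl; sym; trans; cong; cong₂; subst; subst₂; module ≡-Reasoning)

+-cancelʳ-≤ : ∀ {i j} k → i + k ≤ j + k → i ≤ j
+-cancelʳ-≤ {i} {j} k le = subst₂ _≤_ (add-sub i k) (add-sub j k) (+-monoˡ-≤ (- k) le)
  where
  add-sub : ∀ x y → x + y - y ≡ x
  add-sub = solve-∀

cancel-difference : ∀ z {x y} → x ≡ y → z + (x - y) ≡ z
cancel-difference z {x} refl = trans (cong (_+_ z) (+-inverseʳ x)) (+-identityʳ z)

difference-one : ∀ {x y} → x ≡ + 1 + y → x - y ≡ + 1
difference-one {y = y} refl = one-plus-minus y
  where
  one-plus-minus : ∀ y → + 1 + y - y ≡ + 1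
  one-plus-minus = solve-∀

one≰zero : ¬ (+ 1 ≤ 0ℤ)
one≰zero (+≤+ ())

positive-factor : ∀ {b k m} → 0ℤ < k → 0ℤ ≤ m → b * k ≡ + 1 + m → 0ℤ < b
positive-factor {k = k} 0<k 0≤m eq =
  *-cancelʳ-<-nonNeg k {{nonNegative (<⇒≤ 0<k)}}
    (subst (0ℤ <_) (sym eq) (+-mono-<-≤ (+<+ (ℕ.s≤s ℕ.z≤n)) 0≤m))

-- If b·k = 1 + a·c with 0 < a ≤ b and 0 ≤ c < k, then a = 1: indeed
-- b + a·c ≤ b·(1 + c) ≤ b·k = 1 + a·c forces b ≤ 1.
squeeze : ∀ {a b c k} → 0ℤ < a → a ≤ b → 0ℤ ≤ c → c < k →
          b * k ≡ + 1 + a * c → a ≡ + 1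
squeeze {a} {b} {c} {k} 0<a a≤b 0≤c c<k eq =
  ≤-antisym (≤-trans a≤b b≤1) (i<j⇒suc[i]≤j 0<a)
  where
  0≤b : 0ℤ ≤ b
  0≤b = ≤-trans (<⇒≤ 0<a) a≤b
  factor : ∀ b c → b + b * c ≡ b * (+ 1 + c)
  factor = solve-∀
  b≤1 : b ≤ + 1
  b≤1 = +-cancelʳ-≤ (a * c) (begin
    b + a * c     ≤⟨ +-monoʳ-≤ b (*-monoʳ-≤-nonNeg c {{nonNegative 0≤c}} a≤b) ⟩
    b + b * c     ≡⟨ factor b c ⟩
    b * (+ 1 + c) ≤⟨ *-monoˡ-≤-nonNeg b {{nonNegative 0≤b}} (i<j⇒suc[i]≤j c<k) ⟩
    b * k         ≡⟨ eq ⟩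
    + 1 + a * c   ∎)
    where open ≤-Reasoning

-- If 1 + b·b' = a·a' with b > 0 and b' ≥ 0, then a ≤ b or a' ≤ b':
-- otherwise a·a' ≥ (1 + b)(1 + b') = 1 + b·b' + (b + b') > 1 + b·b'.
dominated : ∀ {a a' b b'} → 0ℤ < b → 0ℤ ≤ b' → + 1 + b * b' ≡ a * a' →
            a ≤ b ⊎ a' ≤ b'
dominated {a} {a'} {b} {b'} 0<b 0≤b' eq with a ≤? b | a' ≤? b'
... | yes a≤b | _        = inj₁ a≤b
... | no _    | yes a'≤b' = inj₂ a'≤b'
... | no a≰b  | no a'≰b' = ⊥-elim (<-irrefl refl (begin-strict
    + 1 + b * b'               ≡⟨ sym (+-identityʳ _) ⟩
    (+ 1 + b * b') + 0ℤ        <⟨ +-monoʳ-< (+ 1 + b * b') (+-mono-<-≤ 0<b 0≤b') ⟩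
    (+ 1 + b * b') + (b + b')  ≡⟨ expand b b' ⟩
    (+ 1 + b) * (+ 1 + b')     ≤⟨ *-monoʳ-≤-nonNeg (+ 1 + b') {{nonNegative 0≤1+b'}}
                                    (i<j⇒suc[i]≤j (≰⇒> a≰b)) ⟩
    a * (+ 1 + b')             ≤⟨ *-monoˡ-≤-nonNeg a {{nonNegative (<⇒≤ 0<a)}}
                                    (i<j⇒suc[i]≤j (≰⇒> a'≰b')) ⟩
    a * a'                     ≡⟨ sym eq ⟩
    + 1 + b * b'               ∎))
  where
  open ≤-Reasoning
  expand : ∀ b b' → (+ 1 + b * b') + (b + b') ≡ (+ 1 + b) * (+ 1 + b')
  expand = solve-∀
  0≤1+b' : 0ℤ ≤ + 1 + b'
  0≤1+b' = +-mono-≤ (+≤+ ℕ.z≤n) 0≤b'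
  0<a : 0ℤ < a
  0<a = <-trans 0<b (≰⇒> a≰b)

not-one : ∀ {u b b'} → 0ℤ < u → 0ℤ < b → 0ℤ < b' → ¬ (u + b * b' ≡ + 1)
not-one {b' = b'} 0<u 0<b 0<b' eq = two≰one (subst (+ 2 ≤_) eq
  (+-mono-≤ (i<j⇒suc[i]≤j 0<u) (i<j⇒suc[i]≤j (*-monoʳ-<-pos b' {{positive 0<b'}} 0<b))))
  where
  two≰one : ¬ (+ 2 ≤ + 1)
  two≰one (+≤+ (ℕ.s≤s ()))

record UnimodularPair (a b : ℕ → ℤ) : Set where
  field
    a-positive : ∀ d → 0ℤ < a d
    a-zero     : a 0 ≡ + 1
    b-zero     : b 0 ≡ 0ℤ
    step       : ∀ d → b (suc d) * a d ≡ + 1 + a (suc d) * b d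

module _ {a b : ℕ → ℤ} (P : UnimodularPair a b) where
  open UnimodularPair P

  b-positive    : ∀ d → 0ℤ < b (suc d)
  b-nonNegative : ∀ d → 0ℤ ≤ b d
  b-positive d = positive-factor (a-positive d)
    (*-monoʳ-≤-nonNeg (b d) {{nonNegative (b-nonNegative d)}} (<⇒≤ (a-positive (suc d))))
    (step d)
  b-nonNegative zero    = ≤-reflexive (sym b-zero)
  b-nonNegative (suc d) = <⇒≤ (b-positive d)

  -- Walk
  -- towards the anchor while a ≤ b; this stops before index 0 since
  -- a 0 = 1 > 0 = b 0, and where it stops the step equation squeezes a to 1.
  descent : ∀ d → a (suc d) ≤ b (suc d) → ∃[ e ] a (suc e) ≡ + 1
  descent d a≤b with a d ≤? b d
  descent d a≤b       | no a≰b  =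
    d , squeeze (a-positive (suc d)) a≤b (b-nonNegative d) (≰⇒> a≰b) (step d)
  descent zero a≤b    | yes a≤b₀ = ⊥-elim (one≰zero (subst₂ _≤_ a-zero b-zero a≤b₀))
  descent (suc d) a≤b | yes a≤b' = descent d a≤b'

Unimodular : (ℕ → ℕ → ℤ) → Set
Unimodular v = ∀ d e → v (suc d) e * v d (suc e) ≡ + 1 + v (suc d) (suc e) * v d e

record Quadrant : Set where
  field
    u            : ℕ → ℕ → ℤ
    u-positive   : ∀ d e → 0ℤ < u d e
    u-unimodular : Unimodular u

transpose : Quadrant → Quadrant
transpose Q = record
  { u            = λ d e → u e d
  ; u-positive   = λ d e → u-positive e d
  ; u-unimodular = λ d e → trans (*-comm (u e (suc d)) (u (suc e) d)) (u-unimodular e d)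
  }
  where open Quadrant Q

-- The minor of v on rows 0, d and columns 0, 1, with v 0 0 replaced by 1.
edge : (ℕ → ℕ → ℤ) → ℕ → ℤ
edge v d = v d 0 * v 0 1 - v d 1

-- The first column and the edge minors of a unimodular array satisfy the
-- step equation of a unimodular pair; this is the rule in the first two
-- columns.
edge-step : ∀ v → Unimodular v →
            ∀ d → edge v (suc d) * v d 0 ≡ + 1 + v (suc d) 0 * edge v d
edge-step v rule d =
  trans (rearrange (v d 0) (v (suc d) 0) (v 0 1) (v d 1) (v (suc d) 1))
        (cancel-difference _ (rule d 0))
  where
  rearrange : ∀ a a' c w w' →
    (a' * c - w') * a ≡ (+ 1 + a' * (a * c - w)) + (a' * w - (+ 1 + w' * a))
  rearrange = solve-∀

edge-zero : ∀ v → v 0 0 ≡ + 1 → edge v 0 ≡ 0ℤ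
edge-zero v apex = trans (cong (λ x → x * v 0 1 - v 0 1) apex)
  (trans (cong (_- v 0 1) (*-identityˡ (v 0 1))) (+-inverseʳ (v 0 1)))

-- Cauchy–Binet for 2×2 minors: the array with entries a·c - α·β is
-- unimodular whenever the pairs (a , α) and (c , β) are.
product-unimodular : ∀ a a' α α' c c' β β' →
  α' * a ≡ + 1 + a' * α → β' * c ≡ + 1 + c' * β →
  (a' * c - α' * β) * (a * c' - α * β') ≡ + 1 + (a' * c' - α' * β') * (a * c - α * β)
product-unimodular a a' α α' c c' β β' eα eβ =
  trans (binet a a' α α' c c' β β')
        (cong₂ (λ x y → x * y + (a' * c' - α' * β') * (a * c - α * β))
               (difference-one eα) (difference-one eβ))
  where
  binet : ∀ a a' α α' c c' β β' →
    (a' * c - α' * β) * (a * c' - α * β')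
      ≡ (α' * a - a' * α) * (β' * c - c' * β) + (a' * c' - α' * β') * (a * c - α * β)
  binet = solve-∀

-- A unimodular array with positive entries is determined by its first row
-- and column: the rule expresses u (d+1) (e+1) · u d e through entries
-- closer to the axes.
unimodular-unique : ∀ {u v} → (∀ d e → 0ℤ < u d e) → Unimodular u → Unimodular v →
  (∀ d → u d 0 ≡ v d 0) → (∀ e → u 0 e ≡ v 0 e) → ∀ d e → u d e ≡ v d e
unimodular-unique {u} {v} pos ru rv column row = agree
  where
  agree : ∀ d e → u d e ≡ v d e
  agree zero    e       = row e
  agree (suc d) zero    = column (suc d)
  agree (suc d) (suc e) =
    *-cancelʳ-≡ _ _ (u d e) {{>-nonZero (pos d e)}} (∙-cancelˡ (+ 1) _ _ (begin
      + 1 + u (suc d) (suc e) * u d e ≡⟨ sym (ru d e) ⟩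
      u (suc d) e * u d (suc e)       ≡⟨ cong₂ _*_ (agree (suc d) e) (agree d (suc e)) ⟩
      v (suc d) e * v d (suc e)       ≡⟨ rv d e ⟩
      + 1 + v (suc d) (suc e) * v d e ≡⟨ cong (λ x → + 1 + v (suc d) (suc e) * x) (sym (agree d e)) ⟩
      + 1 + v (suc d) (suc e) * u d e ∎))
    where open ≡-Reasoning

column-pair : (Q : Quadrant) → Quadrant.u Q 0 0 ≡ + 1 →
              UnimodularPair (λ d → Quadrant.u Q d 0) (edge (Quadrant.u Q))
column-pair Q apex = record
  { a-positive = λ d → u-positive d 0
  ; a-zero     = apex
  ; b-zero     = edge-zero u apex
  ; step       = edge-step u u-unimodular
  }
  where open Quadrant Q

module _ (Q : Quadrant) (apex : Quadrant.u Q 0 0 ≡ + 1) where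
  open Quadrant Q

  α β : ℕ → ℤ
  α = edge u
  β = edge (Quadrant.u (transpose Q))

  first-column : UnimodularPair (λ d → u d 0) α
  first-column = column-pair Q apex

  first-row : UnimodularPair (λ e → u 0 e) β
  first-row = column-pair (transpose Q) apex

  rank-two : ℕ → ℕ → ℤ
  rank-two d e = u d 0 * u 0 e - α d * β e

  rank-two-unimodular : Unimodular rank-two
  rank-two-unimodular d e =
    product-unimodular (u d 0) (u (suc d) 0) (α d) (α (suc d))
                       (u 0 e) (u 0 (suc e)) (β e) (β (suc e))
                       (UnimodularPair.step first-column d)
                       (UnimodularPair.step first-row e)

  -- Since α 0 = β 0 = 0 and u 0 0 = 1, the rank-two array has the same
  -- first column and first row as u.
  rank-two-column : ∀ d → u d 0 ≡ rank-two d 0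
  rank-two-column d = trans (times-one (u d 0) (α d))
    (sym (cong₂ (λ y z → u d 0 * y - α d * z) apex (UnimodularPair.b-zero first-row)))
    where
    times-one : ∀ x w → x ≡ x * + 1 - w * 0ℤ
    times-one = solve-∀

  rank-two-row : ∀ e → u 0 e ≡ rank-two 0 e
  rank-two-row e = trans (one-times (u 0 e) (β e))
    (sym (cong₂ (λ y z → y * u 0 e - z * β e) apex (UnimodularPair.b-zero first-column)))
    where
    one-times : ∀ x w → x ≡ + 1 * x - 0ℤ * w
    one-times = solve-∀

  factorisation : ∀ d e → u d e + α d * β e ≡ u d 0 * u 0 e
  factorisation d e =
    trans (cong (_+ α d * β e) (agree d e)) (sub-add (u d 0 * u 0 e) (α d * β e))
    where
    agree : ∀ d e → u d e ≡ rank-two d e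
    agree = unimodular-unique u-positive u-unimodular rank-two-unimodular
              rank-two-column rank-two-row
    sub-add : ∀ x y → x - y + y ≡ x
    sub-add = solve-∀

  -- A 1 in the interior of the quadrant forces a 1 on exactly one axis:
  -- by the factorisation 1 + α·β = u (d+1) 0 · u 0 (e+1), so one axis entry
  -- is dominated by its edge minor and descent applies; 1s on both axes
  -- would give u + α·β = 1 with all three terms positive.
  corner-theorem : (∃[ d ] ∃[ e ] u (suc d) (suc e) ≡ + 1) →
    ExactlyOne (∃[ d ] u (suc d) 0 ≡ + 1) (∃[ e ] u 0 (suc e) ≡ + 1)
  corner-theorem (d , e , one) = some-axis , not-both
    where
    some-axis : (∃[ d ] u (suc d) 0 ≡ + 1) ⊎ (∃[ e ] u 0 (suc e) ≡ + 1)
    some-axis = ⊎-map (descent first-column d) (descent first-row e)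
      (dominated (b-positive first-column d) (b-nonNegative first-row (suc e))
        (trans (cong (_+ α (suc d) * β (suc e)) (sym one)) (factorisation (suc d) (suc e))))
    not-both : ¬ ((∃[ d ] u (suc d) 0 ≡ + 1) × (∃[ e ] u 0 (suc e) ≡ + 1))
    not-both ((d' , one-d) , (e' , one-e)) =
      not-one (u-positive (suc d') (suc e')) (b-positive first-column d')
              (b-positive first-row e')
              (trans (factorisation (suc d') (suc e')) (cong₂ _*_ one-d one-e))

ExactlyOne-map : ∀ {A A' B B' : Set} → A ⇔ A' → B ⇔ B' → ExactlyOne A B → ExactlyOne A' B'
ExactlyOne-map A⇔A' B⇔B' (either , not-both) =
  ⊎-map (to A⇔A') (to B⇔B') either ,
  λ (a' , b') → not-both (from A⇔A' a' , from B⇔B' b')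
  where open Equivalence

above : ∀ {j x} → j < x → ∃[ n ] x ≡ j + + suc n
above {j} {x} j<x = ∣ gap ∣ , (begin
    x                    ≡⟨ regroup j x ⟩
    j + (+ 1 + gap)      ≡⟨ cong (λ g → j + (+ 1 + g)) (sym (0≤i⇒+∣i∣≡i 0≤gap)) ⟩
    j + (+ 1 + + ∣ gap ∣) ∎)
  where
  open ≡-Reasoning
  gap : ℤ
  gap = x - (+ 1 + j)
  0≤gap : 0ℤ ≤ gap
  0≤gap = i≤j⇒0≤j-i (i<j⇒suc[i]≤j j<x)
  regroup : ∀ j x → x ≡ j + (+ 1 + (x - (+ 1 + j)))
  regroup = solve-∀

above-offset : ∀ j n → j < j + + suc n
above-offset j n = subst (_< j + + suc n) (+-identityʳ j) (+-monoʳ-< j (+<+ (ℕ.s≤s ℕ.z≤n)))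

below : ∀ {j x} → x < j → ∃[ n ] x ≡ j - + suc n
below {j} {x} x<j with above x<j
... | n , refl = n , add-sub x (+ suc n)
  where
  add-sub : ∀ x m → x ≡ x + m - m
  add-sub = solve-∀

below-offset : ∀ j n → j - + suc n < j
below-offset j n = subst (j - + suc n <_) (sub-add j (+ suc n)) (above-offset (j - + suc n) n)
  where
  sub-add : ∀ x m → x - m + m ≡ x
  sub-add = solve-∀

_↑_ _↓_ : ℤ → ℕ → ℤ
j ↑ zero  = j
j ↑ suc n = j + + suc n
j ↓ zero  = j
j ↓ suc n = j - + suc n

↑-step : ∀ j n → j ↑ n + + 1 ≡ j ↑ suc n
↑-step j zero    = refl
↑-step j (suc n) = shift j (+ suc n)
  where
  shift : ∀ j m → j + m + + 1 ≡ j + (+ 1 + m)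
  shift = solve-∀

↓-step : ∀ j n → j ↓ suc n + + 1 ≡ j ↓ n
↓-step j zero    = unshift j
  where
  unshift : ∀ j → j - + 1 + + 1 ≡ j
  unshift = solve-∀
↓-step j (suc n) = shift j (+ suc n)
  where
  shift : ∀ j m → j - (+ 1 + m) + + 1 ≡ j - m
  shift = solve-∀

module _ (T : SL2Tiling) where
  open SL2Tiling T renaming (positive to t-positive)

  diamond-at : ∀ {x x' y y'} → x + + 1 ≡ x' → y + + 1 ≡ y' →
               + t x y * + t x' y' ≡ + 1 + + t x y' * + t x' y
  diamond-at {x} {y = y} refl refl = begin
    + t x y * + t (x + + 1) (y + + 1)             ≡⟨ sym (pos-* (t x y) _) ⟩
    + (t x y ℕ.* t (x + + 1) (y + + 1))           ≡⟨ cong +_ (diamond x y) ⟩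
    + 1 + + (t x (y + + 1) ℕ.* t (x + + 1) y)      ≡⟨ cong (_+_ (+ 1)) (pos-* (t x (y + + 1)) _) ⟩
    + 1 + + t x (y + + 1) * + t (x + + 1) y        ∎
    where open ≡-Reasoning

  north-east : ℤ → ℤ → Quadrant
  north-east j p = record
    { u            = λ d e → + t (j ↓ d) (p ↑ e)
    ; u-positive   = λ d e → +<+ (t-positive (j ↓ d) (p ↑ e))
    ; u-unimodular = λ d e → diamond-at (↓-step j d) (↑-step p e)
    }

  south-west : ℤ → ℤ → Quadrant
  south-west j p = record
    { u            = λ d e → + t (j ↑ d) (p ↓ e)
    ; u-positive   = λ d e → +<+ (t-positive (j ↑ d) (p ↓ e))
    ; u-unimodular = λ d e →
        trans (*-comm (+ t (j ↑ suc d) (p ↓ e)) (+ t (j ↑ d) (p ↓ suc e)))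
          (trans (diamond-at (↑-step j d) (↓-step p e))
                 (cong (_+_ (+ 1)) (*-comm (+ t (j ↑ d) (p ↓ e)) (+ t (j ↑ suc d) (p ↓ suc e)))))
    }

  ray : (R : ℤ → Set) (position : ℕ → ℤ) → (∀ n → R (position n)) →
        (∀ {z} → R z → ∃[ n ] z ≡ position n) → (entry : ℤ → ℕ) →
        (∃[ n ] + entry (position n) ≡ + 1) ⇔ (∃[ z ] (R z × entry z ≡ 1))
  ray R position in-R onto entry = mk⇔ to from
    where
    to : (∃[ n ] + entry (position n) ≡ + 1) → ∃[ z ] (R z × entry z ≡ 1)
    to (n , one) = position n , in-R n , +-injective one
    from : (∃[ z ] (R z × entry z ≡ 1)) → ∃[ n ] + entry (position n) ≡ + 1
    from (z , r , one) with onto r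
    ... | n , refl = n , cong +_ one

-- Part (i) is the corner theorem for the quadrant north-east of (j , p),
-- part (ii) for the one south-west of it; `ray` translates between the
-- ℕ-indexed axes of the quadrant and the conditions x < j, y > p, etc.
proposition8p1 : (T : SL2Tiling) → (j p : ℤ) → SL2Tiling.t T j p ≡ 1 →
    ((∃[ x ] ∃[ y ] (x < j × y > p × SL2Tiling.t T x y ≡ 1)) →
      ExactlyOne (∃[ x ] (x < j × SL2Tiling.t T x p ≡ 1))
                 (∃[ y ] (y > p × SL2Tiling.t T j y ≡ 1)))
  × ((∃[ x ] ∃[ y ] (x > j × y < p × SL2Tiling.t T x y ≡ 1)) →
      ExactlyOne (∃[ x ] (x > j × SL2Tiling.t T x p ≡ 1))
                 (∃[ y ] (y < p × SL2Tiling.t T j y ≡ 1)))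
proposition8p1 T j p apex = part-i , part-ii
  where
  open SL2Tiling T
  part-i : (∃[ x ] ∃[ y ] (x < j × y > p × t x y ≡ 1)) →
    ExactlyOne (∃[ x ] (x < j × t x p ≡ 1)) (∃[ y ] (y > p × t j y ≡ 1))
  part-i (x , y , x<j , p<y , one) with below x<j | above p<y
  ... | d , refl | e , refl =
    ExactlyOne-map (ray T (_< j) (λ n → j - + suc n) (below-offset j) below (λ z → t z p))
                   (ray T (p <_) (λ n → p + + suc n) (above-offset p) above (t j))
                   (corner-theorem (north-east T j p) (cong +_ apex) (d , e , cong +_ one))
  part-ii : (∃[ x ] ∃[ y ] (x > j × y < p × t x y ≡ 1)) →
    ExactlyOne (∃[ x ] (x > j × t x p ≡ 1)) (∃[ y ] (y < p × t j y ≡ 1))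
  part-ii (x , y , j<x , y<p , one) with above j<x | below y<p
  ... | d , refl | e , refl =
    ExactlyOne-map (ray T (j <_) (λ n → j + + suc n) (above-offset j) above (λ z → t z p))
                   (ray T (_< p) (λ n → p - + suc n) (below-offset p) below (t j))
                   (corner-theorem (south-west T j p) (cong +_ apex) (d , e , cong +_ one))
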